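{- Let $G$ be a finite simple graph and $T$ its toll walk transit function. Then $T$ satisfies Axiom (JC) on $G$ if and only if $G$ is a chordal graph.
   Context: In a finite simple graph $G$, a walk $W=w_1w_2\cdots w_k$ ($k\ge 2$) is a toll walk if $w_1\neq w_k$, $w_2$ is the only neighbor of $w_1$ among the vertices of $W$, and $w_{k-1}$ is the only neighbor of $w_k$ among the vertices of $W$. The toll walk transit function $T$ of $G$ is given by $T(u,u)=\{u\}$ and, for $u\ne v$, $T(u,v)$ is the set of all vertices lying on some toll walk from $u$ to $v$. A graph is chordal if it has no induced cycle of length at least four. Axiom (JC) for $R=T$ on $V=V(G)$: for all pairwise distinct $u,x,y,v\in V$, if $x\in R(u,y)$, $y\in R(x,v)$ and $R(x,y)=\{x,y\}$, then $x\in R(u,v)$. -}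

module Defs where

open import Data.Nat using (ℕ; zero; suc; _≤_)
open import Data.Fin using (Fin; toℕ)
open import Data.Bool using (Bool; true; false)
open import Data.List using (List; []; _∷_; _++_)
open import Data.List.Membership.Propositional using (_∈_)
open import Data.List.Relation.Unary.Linked using (Linked)
open import Data.Product using (_×_; Σ; ∃)
open import Data.Sum using (_⊎_)
open import Relation.Binary.PropositionalEquality using (_≡_; _≢_)
open import Relation.Nullary using (¬_)
open import Function.Definitions using (Injective)

record Graph (n : ℕ) : Set where
  field
    adj    : Fin n → Fin n → Bool
    sym    : ∀ u v → adj u v ≡ adj v u
    irrefl : ∀ u → adj u u ≡ false

module _ {n : ℕ} (G : Graph n) where
  open Graph G

  Adj : Fin n → Fin n → Set
  Adj u v = adj u v ≡ true

  walkList : Fin n → List (Fin n) → Fin n → List (Fin n)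
  walkList u mid v = u ∷ (mid ++ (v ∷ []))

  second : List (Fin n) → Fin n → Fin n
  second []      v = v
  second (m ∷ _) v = m

  penult : Fin n → List (Fin n) → Fin n
  penult u []       = u
  penult u (m ∷ ms) = penult m ms

  IsTollWalk : Fin n → List (Fin n) → Fin n → Set
  IsTollWalk u mid v =
    u ≢ v
    × Linked Adj (walkList u mid v)
    × (∀ x → x ∈ walkList u mid v → Adj u x → x ≡ second mid v)
    × (∀ x → x ∈ walkList u mid v → Adj v x → x ≡ penult u mid)

  InT : Fin n → Fin n → Fin n → Set
  InT u v x =
    (u ≡ v × x ≡ u)
    ⊎ (u ≢ v × Σ (List (Fin n)) λ mid → IsTollWalk u mid v × x ∈ walkList u mid v)

  JC : Set
  JC = ∀ u x y v →
    u ≢ x → u ≢ y → u ≢ v → x ≢ y → x ≢ v → y ≢ v →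
    InT u y x → InT x v y →
    (∀ z → (InT x y z → (z ≡ x ⊎ z ≡ y)) × ((z ≡ x ⊎ z ≡ y) → InT x y z)) →
    InT u v x

  CycAdj : (k : ℕ) → Fin k → Fin k → Set
  CycAdj k i j =
    suc (toℕ i) ≡ toℕ j ⊎ suc (toℕ j) ≡ toℕ i
    ⊎ (toℕ i ≡ 0 × suc (toℕ j) ≡ k) ⊎ (toℕ j ≡ 0 × suc (toℕ i) ≡ k)

  IsInducedCycle : (k : ℕ) → (Fin k → Fin n) → Set
  IsInducedCycle k c =
    Injective _≡_ _≡_ c
    × (∀ i j → (Adj (c i) (c j) → CycAdj k i j) × (CycAdj k i j → Adj (c i) (c j)))

  Chordal : Set
  Chordal = ∀ k → 4 ≤ k → (c : Fin k → Fin n) → ¬ IsInducedCycle k c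

-- (⇐) Given x ∈ T(u,y), y ∈ T(x,v) and T(x,y) = {x,y}, the vertices x and y are adjacent.
-- Cut the toll walk from u to y at its first visit of x, the one from x to v at its last
-- visit of y, and join the pieces u ⋯ x and y ⋯ v through the edge xy.  No vertex of the
-- first piece is adjacent to y and none of the second is adjacent to x, so an edge between
-- the pieces would close, with xy, a cycle in which no vertex other than x, y is a common
-- neighbour of x and y.  Removing repeated vertices and chords from a shortest such closed
-- walk leaves an induced cycle of length at least four, impossible in a chordal graph.  So
-- u and v have no neighbours across the pieces and the joined walk is a toll walk from u
-- to v through x.
-- (⇒) An induced cycle of length at least four violates (JC) directly.

module Submission where

open import Data.Bool using (true)
import Data.Bool as Bool
open import Data.Empty using (⊥-elim)
open import Data.Fin using (Fin; toℕ)
import Data.Fin as Fin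
open import Data.Fin.Properties using (toℕ-injective; toℕ<n; toℕ-fromℕ<)
open import Data.List using (List; []; _∷_; _++_; _∷ʳ_; length; applyUpTo)
open import Data.List.Properties using (++-assoc; ++-conicalʳ; length-++; applyUpTo-∷ʳ)
open import Data.List.Membership.Propositional using (_∈_; _∉_)
open import Data.List.Membership.Propositional.Properties
  using (∈-++⁺ˡ; ∈-++⁺ʳ; ∈-++⁻; ∈-∃++; ∈-applyUpTo⁺; ∈-applyUpTo⁻)
open import Data.List.Relation.Unary.Any using (here; there)
open import Data.List.Relation.Unary.Linked using (Linked; []; [-]; _∷_; head; tail)
open import Data.List.Relation.Unary.Linked.Properties using (applyUpTo⁺₁)
open import Data.Nat
  using (ℕ; zero; suc; _+_; _∸_; _≤_; _<_; _≟_; _≤?_; _<?_; z≤n; s≤s; s≤s⁻¹; s<s)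
open import Data.Nat.DivMod using (_mod_; m<n⇒m%n≡m)
open import Data.Nat.Induction using (<-wellFounded)
open import Data.Nat.Properties
open import Data.Product using (∃; ∃₂; _×_; _,_; proj₁; proj₂)
open import Data.Sum using (_⊎_; inj₁; inj₂; [_,_]′)
open import Function using (_∘_)
open import Induction.WellFounded using (Acc; acc)
open import Relation.Binary using (DecidableEquality; tri<; tri≈; tri>)
open import Relation.Binary.PropositionalEquality
  using (_≡_; _≢_; refl; sym; trans; cong; subst; subst₂)
open import Relation.Nullary using (¬_; Dec; yes; no)
open import Relation.Nullary.Decidable using (_×-dec_; _⊎-dec_; ¬?; map′)

open import Defs

module _ {X : Set} where

  index : X → List X → ℕ → X
  index d []       _       = d
  index d (z ∷ zs) zero    = z
  index d (z ∷ zs) (suc i) = index d zs i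

  index-++ˡ : ∀ d xs {ys i} → i < length xs → index d (xs ++ ys) i ≡ index d xs i
  index-++ˡ d (_ ∷ _)  {i = zero}  _          = refl
  index-++ˡ d (_ ∷ xs) {i = suc i} (s≤s i<n) = index-++ˡ d xs i<n

  index-length : ∀ d xs {z ys} → index d (xs ++ z ∷ ys) (length xs) ≡ z
  index-length d []       = refl
  index-length d (_ ∷ xs) = index-length d xs

  index-∈ : ∀ d xs {i} → i < length xs → index d xs i ∈ xs
  index-∈ d (_ ∷ _)  {zero}  _          = here refl
  index-∈ d (_ ∷ xs) {suc i} (s≤s i<n) = there (index-∈ d xs i<n)

  ∈-∷ʳ⇒∈-++∷ : ∀ (xs : List X) {a ys} {z : X} → z ∈ xs ∷ʳ a → z ∈ xs ++ a ∷ ys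
  ∈-∷ʳ⇒∈-++∷ []       (here refl) = here refl
  ∈-∷ʳ⇒∈-++∷ (_ ∷ _)  (here refl) = here refl
  ∈-∷ʳ⇒∈-++∷ (_ ∷ xs) (there z∈)  = there (∈-∷ʳ⇒∈-++∷ xs z∈)

module _ {X : Set} {R : X → X → Set} where

  Linked-index : ∀ d xs {i} → Linked R xs → suc i < length xs → R (index d xs i) (index d xs (suc i))
  Linked-index d (_ ∷ [])              [-]     (s≤s ())
  Linked-index d (_ ∷ _ ∷ _)  {zero}  (r ∷ _) _           = r
  Linked-index d (_ ∷ _ ∷ xs) {suc i} (_ ∷ l) (s≤s i<n) = Linked-index d (_ ∷ xs) l i<n

  Linked-++⁻ˡ : ∀ xs {ys} → Linked R (xs ++ ys) → Linked R xs
  Linked-++⁻ˡ []           _       = []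
  Linked-++⁻ˡ (_ ∷ [])     _       = [-]
  Linked-++⁻ˡ (_ ∷ _ ∷ xs) (r ∷ l) = r ∷ Linked-++⁻ˡ (_ ∷ xs) l

  Linked-++⁻ʳ : ∀ xs {ys} → Linked R (xs ++ ys) → Linked R ys
  Linked-++⁻ʳ []       l = l
  Linked-++⁻ʳ (_ ∷ xs) l = Linked-++⁻ʳ xs (tail l)

  Linked-∷ʳ⁻ : ∀ xs {a ys} → Linked R (xs ++ a ∷ ys) → Linked R (xs ∷ʳ a)
  Linked-∷ʳ⁻ []           _       = [-]
  Linked-∷ʳ⁻ (_ ∷ [])     (r ∷ _) = r ∷ [-]
  Linked-∷ʳ⁻ (_ ∷ _ ∷ xs) (r ∷ l) = r ∷ Linked-∷ʳ⁻ (_ ∷ xs) l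

  Linked-join : ∀ xs {a b ys} → Linked R (xs ∷ʳ a) → R a b → Linked R (b ∷ ys) →
                Linked R (xs ++ a ∷ b ∷ ys)
  Linked-join []           _       r l = r ∷ l
  Linked-join (_ ∷ [])     (q ∷ _) r l = q ∷ r ∷ l
  Linked-join (_ ∷ _ ∷ xs) (q ∷ k) r l = q ∷ Linked-join (_ ∷ xs) k r l

  Linked-predecessor : ∀ {a as z} → Linked R (a ∷ as) → z ∈ as → ∃ λ w → w ∈ a ∷ as × R w z
  Linked-predecessor (r ∷ _) (here refl) = _ , here refl , r
  Linked-predecessor (_ ∷ l) (there z∈)  =
    let w , w∈ , r = Linked-predecessor l z∈ in w , there w∈ , r

  Linked-successor : ∀ zs {b z} → Linked R (zs ∷ʳ b) → z ∈ zs → ∃ λ w → w ∈ zs ∷ʳ b × R z w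
  Linked-successor (_ ∷ [])     (r ∷ _) (here refl) = _ , there (here refl) , r
  Linked-successor (_ ∷ _ ∷ _)  (r ∷ _) (here refl) = _ , there (here refl) , r
  Linked-successor (_ ∷ _ ∷ zs) (_ ∷ l) (there z∈)  =
    let w , w∈ , r = Linked-successor (_ ∷ zs) l z∈ in w , there w∈ , r

  Linked-propagate : ∀ {P : X → Set} {w ws} → Linked R (w ∷ ws) → P w →
                     (∀ {a b} → b ∈ w ∷ ws → P a → R a b → P b) →
                     ∀ {z} → z ∈ w ∷ ws → P z
  Linked-propagate _       pw _    (here refl) = pw
  Linked-propagate (r ∷ l) pw step (there z∈)  =
    Linked-propagate l (step (there (here refl)) pw r) (λ b∈ → step (there b∈)) z∈

module _ {X : Set} (decEq : DecidableEquality X) where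
  open import Data.List.Membership.DecPropositional decEq using (_∈?_)

  ∈-firstSplit : ∀ {x} xs → x ∈ xs → ∃₂ λ ys zs → xs ≡ ys ++ x ∷ zs × x ∉ ys
  ∈-firstSplit {x} (a ∷ as) x∈ with decEq a x | x∈
  ... | yes refl | _          = [] , as , refl , λ ()
  ... | no  a≢x  | here x≡a   = ⊥-elim (a≢x (sym x≡a))
  ... | no  a≢x  | there x∈as =
    let ys , zs , eq , x∉ys = ∈-firstSplit as x∈as
    in a ∷ ys , zs , cong (a ∷_) eq ,
       λ { (here x≡a) → a≢x (sym x≡a) ; (there x∈ys) → x∉ys x∈ys }

  ∈-lastSplit : ∀ {x} xs → x ∈ xs → ∃₂ λ ys zs → xs ≡ ys ++ x ∷ zs × x ∉ zs
  ∈-lastSplit {x} (a ∷ as) x∈ with x ∈? as | x∈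
  ... | yes x∈as | _          =
    let ys , zs , eq , x∉zs = ∈-lastSplit as x∈as in a ∷ ys , zs , cong (a ∷_) eq , x∉zs
  ... | no  x∉as | here refl  = [] , as , refl , x∉as
  ... | no  x∉as | there x∈as = ⊥-elim (x∉as x∈as)

-- CycAdj k i j unfolds to CyclicallyAdjacent k (toℕ i) (toℕ j).
CyclicallyAdjacent : ℕ → ℕ → ℕ → Set
CyclicallyAdjacent k a b = suc a ≡ b ⊎ suc b ≡ a ⊎ (a ≡ 0 × suc b ≡ k) ⊎ (b ≡ 0 × suc a ≡ k)

2+n≤o : ∀ m {n o} → suc (m + n) ≤ o → ¬ (m ≡ 0 × suc (m + n) ≡ o) → 2 + n ≤ o
2+n≤o zero    n<o ¬ends = ≤∧≢⇒< n<o (λ e → ¬ends (refl , e))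
2+n≤o (suc m) m+n<o _     = ≤-trans (s≤s (s≤s (m≤n+m _ m))) m+n<o

module _ {n : ℕ} (G : Graph n) where

  private
    V : Set
    V = Fin n

    _~_ : V → V → Set
    _~_ = Adj G

    variable
      u v w x y z : V

  ~-sym : x ~ y → y ~ x
  ~-sym {x} {y} x~y = trans (Graph.sym G y x) x~y

  ~-irrefl : ¬ x ~ x
  ~-irrefl {x} x~x with trans (sym (Graph.irrefl G x)) x~x
  ... | ()

  ~⇒≢ : x ~ y → x ≢ y
  ~⇒≢ x~y refl = ~-irrefl x~y

  _~?_ : ∀ x y → Dec (x ~ y)
  x ~? y = Graph.adj G x y Bool.≟ true

  second-∈ : ∀ mid → second G mid v ∈ walkList G u mid v
  second-∈ []      = there (here refl)
  second-∈ (_ ∷ _) = there (here refl)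

  ~second : ∀ mid → Linked _~_ (walkList G u mid v) → u ~ second G mid v
  ~second []      = head
  ~second (_ ∷ _) = head

  last-∈ : ∀ mid → v ∈ walkList G u mid v
  last-∈ mid = there (∈-++⁺ʳ mid (here refl))

  second-++ : ∀ P E → second G (P ++ x ∷ E) y ≡ second G P x
  second-++ []      _ = refl
  second-++ (_ ∷ _) _ = refl

  penult-++ : ∀ P E → penult G u (P ++ x ∷ E) ≡ penult G x E
  penult-++ []      _ = refl
  penult-++ (_ ∷ P) E = penult-++ P E

  penult-applyUpTo : ∀ (f : ℕ → V) l → penult G u (applyUpTo f (suc l)) ≡ f l
  penult-applyUpTo f zero    = refl
  penult-applyUpTo f (suc l) = penult-applyUpTo {u = f 0} (f ∘ suc) l

  walkList-++ : ∀ P E → walkList G u (P ++ x ∷ E) y ≡ (u ∷ P) ++ x ∷ E ∷ʳ y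
  walkList-++ {x = x} {y} P E = cong (_ ∷_) (++-assoc P (x ∷ E) (y ∷ []))

  ∈-walkList-++ : ∀ P E → x ∈ walkList G u (P ++ x ∷ E) y
  ∈-walkList-++ {x = x} {u = u} P E = subst (x ∈_) (sym (walkList-++ P E)) (∈-++⁺ʳ (u ∷ P) (here refl))

  ∈-interior : ∀ mid → x ∈ walkList G u mid y → u ≢ x → x ≢ y → x ∈ mid
  ∈-interior mid (here x≡u) u≢x _ = ⊥-elim (u≢x (sym x≡u))
  ∈-interior mid (there x∈) _ x≢y with ∈-++⁻ mid x∈
  ... | inj₁ x∈mid     = x∈mid
  ... | inj₂ (here x≡y) = ⊥-elim (x≢y x≡y)

  TIsPair : V → V → Set
  TIsPair x y = ∀ z → (InT G x y z → z ≡ x ⊎ z ≡ y) × (z ≡ x ⊎ z ≡ y → InT G x y z)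

  -- Along a toll walk between adjacent vertices, each step leads from one end to the other.
  T-edge⁻ : x ~ y → InT G x y z → z ≡ x ⊎ z ≡ y
  T-edge⁻ _ (inj₁ (_ , z≡x)) = inj₁ z≡x
  T-edge⁻ {x} {y} x~y (inj₂ (_ , mid , (_ , linked , x-toll , y-toll) , z∈)) =
    Linked-propagate linked (inj₁ refl) alternate z∈
    where
    alternate : ∀ {a b} → b ∈ walkList G x mid y → a ≡ x ⊎ a ≡ y → a ~ b → b ≡ x ⊎ b ≡ y
    alternate b∈ (inj₁ refl) a~b = inj₂ (trans (x-toll _ b∈ a~b) (sym (x-toll y (last-∈ mid) x~y)))
    alternate b∈ (inj₂ refl) a~b = inj₁ (trans (y-toll _ b∈ a~b) (sym (y-toll x (here refl) (~-sym x~y))))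

  ~⇒TIsPair : x ~ y → TIsPair x y
  ~⇒TIsPair {x} {y} x~y z =
    T-edge⁻ x~y , λ z∈ → inj₂ (x≢y , [] , (x≢y , x~y ∷ [-] , x-toll , y-toll) , pair-∈ z∈)
    where
    x≢y : x ≢ y
    x≢y = ~⇒≢ x~y
    x-toll : ∀ w → w ∈ x ∷ y ∷ [] → x ~ w → w ≡ y
    x-toll _ (here refl)         x~x = ⊥-elim (~-irrefl x~x)
    x-toll _ (there (here refl)) _   = refl
    y-toll : ∀ w → w ∈ x ∷ y ∷ [] → y ~ w → w ≡ x
    y-toll _ (here refl)         _   = refl
    y-toll _ (there (here refl)) y~y = ⊥-elim (~-irrefl y~y)
    pair-∈ : z ≡ x ⊎ z ≡ y → z ∈ x ∷ y ∷ []
    pair-∈ (inj₁ refl) = here refl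
    pair-∈ (inj₂ refl) = there (here refl)

  TIsPair⇒~ : x ≢ y → TIsPair x y → x ~ y
  TIsPair⇒~ {x} {y} x≢y T with proj₂ (T x) (inj₁ refl)
  ... | inj₁ (x≡y , _)              = ⊥-elim (x≢y x≡y)
  ... | inj₂ (_ , mid , walk , _) =
    let x~second = ~second mid (proj₁ (proj₂ walk)) in
    [ (λ second≡x → ⊥-elim (~-irrefl (subst (x ~_) second≡x x~second)))
    , (λ second≡y → subst (x ~_) second≡y x~second)
    ]′ (proj₁ (T (second G mid y)) (inj₂ (x≢y , mid , walk , second-∈ mid)))

  Outside : V → V → V → Set
  Outside x y z = z ≢ x × z ≢ y × ¬ (x ~ z × y ~ z)

  record OutsideWalk (x y : V) (s : ℕ) (g : ℕ → V) : Set where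
    field
      2≤s     : 2 ≤ s
      start   : g 0 ≡ y
      end     : g s ≡ x
      step    : ∀ {i} → i < s → g i ~ g (suc i)
      outside : ∀ {i} → 0 < i → i < s → Outside x y (g i)

  skip : (ℕ → V) → ℕ → ℕ → ℕ → V
  skip g i d k with k ≤? i
  ... | yes _ = g k
  ... | no  _ = g (k + d)

  skip-≤ : ∀ g i d {k} → k ≤ i → skip g i d k ≡ g k
  skip-≤ g i d {k} k≤i with k ≤? i
  ... | yes _   = refl
  ... | no  k≰i = ⊥-elim (k≰i k≤i)

  skip-> : ∀ g i d {k} → i < k → skip g i d k ≡ g (k + d)
  skip-> g i d {k} i<k with k ≤? i
  ... | yes k≤i = ⊥-elim (<⇒≱ i<k k≤i)
  ... | no  _   = refl

  skip-outsideWalk : ∀ {s g i d} → OutsideWalk x y s g → suc (i + d) ≤ s → 2 ≤ s ∸ d →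
                     g i ~ g (suc (i + d)) → OutsideWalk x y (s ∸ d) (skip g i d)
  skip-outsideWalk {x} {y} {s} {g} {i} {d} W i+d<s 2≤s∸d chord = record
    { 2≤s     = 2≤s∸d
    ; start   = trans (skip-≤ g i d z≤n) start
    ; end     = trans (skip-> g i d i<s∸d) (trans (cong g (m∸n+n≡m d≤s)) end)
    ; step    = step′
    ; outside = outside′
    }
    where
    open OutsideWalk W
    d≤s : d ≤ s
    d≤s = ≤-trans (m≤n+m d i) (<⇒≤ i+d<s)
    i<s∸d : i < s ∸ d
    i<s∸d = m+n≤o⇒m≤o∸n (suc i) i+d<s
    i<s : i < s
    i<s = <-≤-trans i<s∸d (m∸n≤m s d)
    shift : ∀ {k} → k < s ∸ d → k + d < s
    shift k<s∸d = m≤o∸n⇒m+n≤o (suc _) d≤s k<s∸d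
    step′ : ∀ {k} → k < s ∸ d → skip g i d k ~ skip g i d (suc k)
    step′ {k} k<s∸d with <-cmp k i
    ... | tri< k<i _ _  = subst₂ _~_ (sym (skip-≤ g i d (<⇒≤ k<i))) (sym (skip-≤ g i d k<i))
                            (step (<-trans k<i i<s))
    ... | tri≈ _ refl _ = subst₂ _~_ (sym (skip-≤ g i d ≤-refl)) (sym (skip-> g i d ≤-refl))
                            chord
    ... | tri> _ _ i<k  = subst₂ _~_ (sym (skip-> g i d i<k)) (sym (skip-> g i d (m<n⇒m<1+n i<k)))
                            (step (shift k<s∸d))
    outside′ : ∀ {k} → 0 < k → k < s ∸ d → Outside x y (skip g i d k)
    outside′ {k} 0<k k<s∸d with ≤-<-connex k i
    ... | inj₁ k≤i = subst (Outside x y) (sym (skip-≤ g i d k≤i)) (outside 0<k (≤-<-trans k≤i i<s))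
    ... | inj₂ i<k = subst (Outside x y) (sym (skip-> g i d i<k))
                      (outside (<-≤-trans 0<k (m≤m+n k d)) (shift k<s∸d))

  -- The pair (0, s) is excluded: g s ~ g 0 is the edge x ~ y closing the walk.
  Chord : (ℕ → V) → ℕ → ℕ → ℕ → Set
  Chord g s i j = suc i < j × j ≤ s × ¬ (i ≡ 0 × j ≡ s) × g i ~ g j

  chord⇒shorter : ∀ {s g i j} → OutsideWalk x y s g → Chord g s i j →
                  ∃₂ λ s′ g′ → s′ < s × OutsideWalk x y s′ g′
  chord⇒shorter {s = s} {g} {i} W (si<j , j≤s , ¬ends , chord) with m≤n⇒∃[o]m+o≡n (<⇒≤ si<j)
  ... | d , refl = s ∸ d , skip g i d , ∸-monoʳ-< 0<d d≤s ,
                   skip-outsideWalk W j≤s (m+n≤o⇒m≤o∸n 2 (2+n≤o i j≤s ¬ends)) chord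
    where
    0<d : 0 < d
    0<d = n≢0⇒n>0 λ d≡0 → <-irrefl (sym (trans (cong (i +_) d≡0) (+-identityʳ i))) (s≤s⁻¹ si<j)
    d≤s : d ≤ s
    d≤s = ≤-trans (m≤n+m d i) (<⇒≤ j≤s)

  Shortcut : (ℕ → V) → ℕ → ℕ → ℕ → Set
  Shortcut g s a b = suc a < b × b ≤ s × ¬ (a ≡ 0 × b ≡ s) × (g a ≡ g b ⊎ g a ~ g b)

  shortcut? : ∀ g s → Dec (∃₂ (Shortcut g s))
  shortcut? g s =
    map′ (λ (b , _ , a , _ , sc) → a , b , sc)
         (λ (a , b , sc) → b , s≤s (proj₁ (proj₂ sc)) , a , <-trans (n<1+n a) (proj₁ sc) , sc)
         (anyUpTo? (λ b → anyUpTo? (λ a → shortcutAt? a b) b) (suc s))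
    where
    shortcutAt? : ∀ a b → Dec (Shortcut g s a b)
    shortcutAt? a b = suc a <? b ×-dec b ≤? s ×-dec ¬? (a ≟ 0 ×-dec b ≟ s)
                      ×-dec (g a Fin.≟ g b ⊎-dec g a ~? g b)

  -- A repeated vertex g a = g b is bypassed by the chord from g a to g (b + 1).
  shortcut⇒chord : ∀ {s g a b} → OutsideWalk x y s g → Shortcut g s a b → ∃₂ (Chord g s)
  shortcut⇒chord W (sa<b , b≤s , ¬ends , inj₂ chord) = _ , _ , sa<b , b≤s , ¬ends , chord
  shortcut⇒chord {s = s} {g} {a} {b} W (sa<b , b≤s , ¬ends , inj₁ ga≡gb) =
    a , suc b , s<s a<b , b<s , a≢0 ∘ proj₁ , subst (_~ g (suc b)) (sym ga≡gb) (step b<s)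
    where
    open OutsideWalk W
    a<b : a < b
    a<b = <-trans (n<1+n a) sa<b
    a≢0 : a ≢ 0
    a≢0 a≡0 with m≤n⇒m<n∨m≡n b≤s
    ... | inj₁ b<s = proj₁ (proj₂ (outside (m<n⇒0<n sa<b) b<s))
                       (trans (sym ga≡gb) (trans (cong g a≡0) start))
    ... | inj₂ b≡s = ¬ends (a≡0 , b≡s)
    b<s : b < s
    b<s = ≤∧≢⇒< b≤s λ b≡s →
      proj₁ (outside (n≢0⇒n>0 a≢0) (<-≤-trans a<b b≤s)) (trans ga≡gb (trans (cong g b≡s) end))

  module ShortcutFree {x y s g} (x~y : x ~ y) (W : OutsideWalk x y s g)
                      (none : ∀ {a b} → ¬ Shortcut g s a b) where
    open OutsideWalk W

    ordered-pair : ∀ {a b} → a < b → b ≤ s →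
                   suc a ≡ b ⊎ (a ≡ 0 × b ≡ s) ⊎ ¬ (g a ≡ g b ⊎ g a ~ g b)
    ordered-pair {a} {b} a<b b≤s with m≤n⇒m<n∨m≡n a<b
    ... | inj₂ sa≡b = inj₁ sa≡b
    ... | inj₁ sa<b with a ≟ 0 ×-dec b ≟ s
    ...   | yes ends = inj₂ (inj₁ ends)
    ...   | no ¬ends = inj₂ (inj₂ λ e → none (sa<b , b≤s , ¬ends , e))

    distinct-< : ∀ {a b} → a < b → b ≤ s → g a ≢ g b
    distinct-< {a} a<b b≤s ga≡gb with ordered-pair a<b b≤s
    ... | inj₁ refl                 = ~-irrefl (subst (g a ~_) (sym ga≡gb) (step b≤s))
    ... | inj₂ (inj₁ (refl , refl)) = ~⇒≢ x~y (trans (sym end) (trans (sym ga≡gb) start))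
    ... | inj₂ (inj₂ ¬e)            = ¬e (inj₁ ga≡gb)

    adjacent-< : ∀ {a b} → a < b → b ≤ s → g a ~ g b → suc a ≡ b ⊎ (a ≡ 0 × b ≡ s)
    adjacent-< a<b b≤s ga~gb with ordered-pair a<b b≤s
    ... | inj₁ sa≡b       = inj₁ sa≡b
    ... | inj₂ (inj₁ ends) = inj₂ ends
    ... | inj₂ (inj₂ ¬e)   = ⊥-elim (¬e (inj₂ ga~gb))

    injective : ∀ {a b} → a ≤ s → b ≤ s → g a ≡ g b → a ≡ b
    injective {a} {b} a≤s b≤s ga≡gb with <-cmp a b
    ... | tri< a<b _ _ = ⊥-elim (distinct-< a<b b≤s ga≡gb)
    ... | tri≈ _ a≡b _ = a≡b
    ... | tri> _ _ b<a = ⊥-elim (distinct-< b<a a≤s (sym ga≡gb))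

    adjacent⇒cyclic : ∀ {a b} → a ≤ s → b ≤ s → g a ~ g b → CyclicallyAdjacent (suc s) a b
    adjacent⇒cyclic {a} {b} a≤s b≤s ga~gb with <-cmp a b
    ... | tri< a<b _ _ with adjacent-< a<b b≤s ga~gb
    ...   | inj₁ sa≡b         = inj₁ sa≡b
    ...   | inj₂ (a≡0 , b≡s)  = inj₂ (inj₂ (inj₁ (a≡0 , cong suc b≡s)))
    adjacent⇒cyclic _ _ ga~gb | tri≈ _ refl _ = ⊥-elim (~-irrefl ga~gb)
    adjacent⇒cyclic {a} {b} a≤s b≤s ga~gb | tri> _ _ b<a with adjacent-< b<a a≤s (~-sym ga~gb)
    ...   | inj₁ sb≡a         = inj₂ (inj₁ sb≡a)
    ...   | inj₂ (b≡0 , a≡s)  = inj₂ (inj₂ (inj₂ (b≡0 , cong suc a≡s)))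

    cyclic⇒adjacent : ∀ {a b} → a ≤ s → b ≤ s → CyclicallyAdjacent (suc s) a b → g a ~ g b
    cyclic⇒adjacent _   b≤s (inj₁ refl)                       = step b≤s
    cyclic⇒adjacent a≤s _   (inj₂ (inj₁ refl))                = ~-sym (step a≤s)
    cyclic⇒adjacent _   _   (inj₂ (inj₂ (inj₁ (refl , refl)))) = subst₂ _~_ (sym start) (sym end) (~-sym x~y)
    cyclic⇒adjacent _   _   (inj₂ (inj₂ (inj₂ (refl , refl)))) = subst₂ _~_ (sym end) (sym start) x~y

    inducedCycle : IsInducedCycle G (suc s) (g ∘ toℕ)
    inducedCycle =
      (λ e → toℕ-injective (injective (bound _) (bound _) e)) ,
      (λ i j → adjacent⇒cyclic (bound i) (bound j) , cyclic⇒adjacent (bound i) (bound j))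
      where
      bound : (i : Fin (suc s)) → toℕ i ≤ s
      bound i = s≤s⁻¹ (toℕ<n i)

  ¬OutsideWalk₂ : ∀ {g} → ¬ OutsideWalk x y 2 g
  ¬OutsideWalk₂ W = proj₂ (proj₂ (outside (s≤s z≤n) 1<2))
    (~-sym (subst (_ ~_) end (step 1<2)) , subst (_~ _) start (step (s≤s z≤n)))
    where
    open OutsideWalk W
    1<2 : 1 < 2
    1<2 = s≤s (s≤s z≤n)

  chordal⇒¬OutsideWalk : Chordal G → x ~ y → ∀ {s g} → ¬ OutsideWalk x y s g
  chordal⇒¬OutsideWalk {x} {y} chordal x~y = go (<-wellFounded _)
    where
    go : ∀ {s g} → Acc _<_ s → ¬ OutsideWalk x y s g
    go {s} {g} (acc shorter) W with shortcut? g s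
    ... | yes (_ , _ , sc) =
      let _ , _ , chord = shortcut⇒chord W sc
          _ , _ , s′<s , W′ = chord⇒shorter W chord
      in go (shorter s′<s) W′
    ... | no ∄sc with s ≟ 2
    ...   | yes refl = ¬OutsideWalk₂ W
    ...   | no s≢2   = chordal (suc s) (s≤s (≤∧≢⇒< (OutsideWalk.2≤s W) (s≢2 ∘ sym)))
                         (g ∘ toℕ) (ShortcutFree.inducedCycle x~y W (λ sc → ∄sc (_ , _ , sc)))

  walkList⇒OutsideWalk : ∀ M → M ≢ [] → Linked _~_ (walkList G y M x) →
                         (∀ {z} → z ∈ M → Outside x y z) →
                         OutsideWalk x y (suc (length M)) (index y (walkList G y M x))
  walkList⇒OutsideWalk []      []≢[] _      _         = ⊥-elim ([]≢[] refl)
  walkList⇒OutsideWalk {y} {x} M@(_ ∷ _) _ linked outside-M = record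
    { 2≤s     = s≤s (s≤s z≤n)
    ; start   = refl
    ; end     = index-length y M
    ; step    = λ {i} i≤M → Linked-index y (walkList G y M x) linked
                  (s≤s (subst (i <_) (sym (trans (length-++ M) (+-comm _ 1))) i≤M))
    ; outside = λ { {suc i} _ (s≤s i<M) →
                  subst (Outside x y) (sym (index-++ˡ y M i<M)) (outside-M (index-∈ y M i<M)) }
    }

  -- u · P · x: a toll walk from u to y, stopped at its first visit of x, where x ~ y.
  record TollHead (u x y : V) (P : List V) : Set where
    field
      linked : Linked _~_ (walkList G u P x)
      toll   : ∀ {z} → z ∈ walkList G u P x → u ~ z → z ≡ second G P x
      avoids : ∀ {z} → z ∈ u ∷ P → z ≢ x × z ≢ y × ¬ y ~ z

  -- y · D · v: a toll walk from x to v, started at its last visit of y, where x ~ y.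
  record TollTail (x y v : V) (D : List V) : Set where
    field
      linked : Linked _~_ (walkList G y D v)
      toll   : ∀ {z} → z ∈ walkList G y D v → v ~ z → z ≡ penult G y D
      avoids : ∀ {z} → z ∈ D ∷ʳ v → z ≢ x × z ≢ y × ¬ x ~ z

  tollHead : ∀ {P E} → x ~ y → u ≢ x → x ∉ P → IsTollWalk G u (P ++ x ∷ E) y → TollHead u x y P
  tollHead {x} {y} {u} {P} {E} x~y u≢x x∉P (u≢y , linked , u-toll , y-toll) = record
    { linked = linked-head
    ; toll   = λ z∈ u~z → trans (u-toll _ (embed z∈) u~z) (second-++ P E)
    ; avoids = λ z∈ → ≢x z∈ , ≢y z∈ , ¬y~ z∈
    }
    where
    linked-head : Linked _~_ (walkList G u P x)
    linked-head = Linked-∷ʳ⁻ (u ∷ P) (subst (Linked _~_) (walkList-++ P E) linked)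
    embed : z ∈ walkList G u P x → z ∈ walkList G u (P ++ x ∷ E) y
    embed {z} z∈ = subst (z ∈_) (sym (walkList-++ P E)) (∈-∷ʳ⇒∈-++∷ (u ∷ P) z∈)
    ≢x : z ∈ u ∷ P → z ≢ x
    ≢x (here refl) = u≢x
    ≢x (there z∈P) refl = x∉P z∈P
    ¬y~ : z ∈ u ∷ P → ¬ y ~ z
    ¬y~ z∈ y~z = ≢x z∈ (trans (y-toll _ (embed (∈-++⁺ˡ z∈)) y~z)
                             (sym (y-toll x (∈-walkList-++ P E) (~-sym x~y))))
    ≢y : z ∈ u ∷ P → z ≢ y
    ≢y (here refl) = u≢y
    ≢y (there z∈P) refl =
      let _ , w∈ , w~y = Linked-predecessor (Linked-++⁻ˡ (u ∷ P) linked-head) z∈P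
      in ¬y~ w∈ (~-sym w~y)

  tollTail : ∀ {C D} → x ~ y → y ≢ v → y ∉ D → IsTollWalk G x (C ++ y ∷ D) v → TollTail x y v D
  tollTail {x} {y} {v} {C} {D} x~y y≢v y∉D (x≢v , linked , x-toll , v-toll) = record
    { linked = linked-tail
    ; toll   = λ z∈ v~z → trans (v-toll _ (embed z∈) v~z) (penult-++ C D)
    ; avoids = λ z∈ → ≢x z∈ , ≢y z∈ , ¬x~ z∈
    }
    where
    linked-tail : Linked _~_ (walkList G y D v)
    linked-tail = Linked-++⁻ʳ (x ∷ C) (subst (Linked _~_) (walkList-++ C D) linked)
    embed : z ∈ walkList G y D v → z ∈ walkList G x (C ++ y ∷ D) v
    embed {z} z∈ = subst (z ∈_) (sym (walkList-++ C D)) (∈-++⁺ʳ (x ∷ C) z∈)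
    ≢y : z ∈ D ∷ʳ v → z ≢ y
    ≢y z∈ refl with ∈-++⁻ D z∈
    ... | inj₁ y∈D        = y∉D y∈D
    ... | inj₂ (here y≡v) = y≢v y≡v
    ¬x~ : z ∈ D ∷ʳ v → ¬ x ~ z
    ¬x~ z∈ x~z = ≢y z∈ (trans (x-toll _ (embed (there z∈)) x~z)
                             (sym (x-toll y (∈-walkList-++ C D) x~y)))
    ≢x : z ∈ D ∷ʳ v → z ≢ x
    ≢x z∈ refl with ∈-++⁻ D z∈
    ... | inj₁ x∈D        =
      let _ , w∈ , x~w = Linked-successor D (tail linked-tail) x∈D in ¬x~ w∈ x~w
    ... | inj₂ (here x≡v) = x≢v x≡v

  -- An edge from the head to the tail would close, together with x ~ y, an outside walk.
  no-cross-edge : ∀ {P D} → Chordal G → x ~ y → TollHead u x y P → TollTail x y v D →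
                  w ∈ u ∷ P → z ∈ D ∷ʳ v → ¬ w ~ z
  no-cross-edge {x} {y} {u} {v} {w} {z} {P} {D} chordal x~y H T w∈ z∈ w~z
    with ∈-∃++ w∈ | ∈-∃++ z∈
  ... | F , F′ , uP≡ | K , K′ , Dv≡ =
    chordal⇒¬OutsideWalk chordal x~y (walkList⇒OutsideWalk M M≢[] linked outside)
    where
    M : List V
    M = K ++ z ∷ w ∷ F′
    M≢[] : M ≢ []
    M≢[] M≡[] with ++-conicalʳ K _ M≡[]
    ... | ()
    linked : Linked _~_ (walkList G y M x)
    linked = subst (Linked _~_) (cong (y ∷_) (sym (++-assoc K (z ∷ w ∷ F′) (x ∷ []))))
      (Linked-join (y ∷ K)
        (Linked-∷ʳ⁻ (y ∷ K) (subst (Linked _~_) (cong (y ∷_) Dv≡) (TollTail.linked T)))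
        (~-sym w~z)
        (Linked-++⁻ʳ F (subst (Linked _~_)
                                (trans (cong (_∷ʳ x) uP≡) (++-assoc F (w ∷ F′) (x ∷ [])))
                                (TollHead.linked H))))
    from-head : ∀ {t} → t ∈ u ∷ P → Outside x y t
    from-head t∈ = let t≢x , t≢y , ¬y~t = TollHead.avoids H t∈ in t≢x , t≢y , ¬y~t ∘ proj₂
    from-tail : ∀ {t} → t ∈ D ∷ʳ v → Outside x y t
    from-tail t∈ = let t≢x , t≢y , ¬x~t = TollTail.avoids T t∈ in t≢x , t≢y , ¬x~t ∘ proj₁
    outside : ∀ {t} → t ∈ M → Outside x y t
    outside t∈ with ∈-++⁻ K t∈
    ... | inj₁ t∈K         = from-tail (subst (_ ∈_) (sym Dv≡) (∈-++⁺ˡ t∈K))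
    ... | inj₂ (here refl) = from-tail z∈
    ... | inj₂ (there t∈′) = from-head (subst (_ ∈_) (sym uP≡) (∈-++⁺ʳ F t∈′))

  splice : ∀ {P D} → Chordal G → x ~ y → u ≢ v → TollHead u x y P → TollTail x y v D →
           IsTollWalk G u (P ++ x ∷ y ∷ D) v
  splice {x} {y} {u} {v} {P} {D} chordal x~y u≢v H T = u≢v , linked , u-toll , v-toll
    where
    linked : Linked _~_ (walkList G u (P ++ x ∷ y ∷ D) v)
    linked = subst (Linked _~_) (sym (walkList-++ P (y ∷ D)))
               (Linked-join (u ∷ P) (TollHead.linked H) x~y (TollTail.linked T))
    sides : z ∈ walkList G u (P ++ x ∷ y ∷ D) v → z ∈ walkList G u P x ⊎ z ∈ walkList G y D v
    sides {z} z∈ with ∈-++⁻ (u ∷ P) (subst (z ∈_) (walkList-++ P (y ∷ D)) z∈)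
    ... | inj₁ z∈uP        = inj₁ (∈-++⁺ˡ z∈uP)
    ... | inj₂ (here refl) = inj₁ (∈-++⁺ʳ (u ∷ P) (here refl))
    ... | inj₂ (there z∈T) = inj₂ z∈T
    v∈ : v ∈ D ∷ʳ v
    v∈ = ∈-++⁺ʳ D (here refl)
    u-toll : ∀ z → z ∈ walkList G u (P ++ x ∷ y ∷ D) v → u ~ z → z ≡ second G (P ++ x ∷ y ∷ D) v
    u-toll z z∈ u~z with sides z∈
    ... | inj₁ z∈H          = trans (TollHead.toll H z∈H u~z) (sym (second-++ P (y ∷ D)))
    ... | inj₂ (here refl)  = ⊥-elim (proj₂ (proj₂ (TollHead.avoids H (here refl))) (~-sym u~z))
    ... | inj₂ (there z∈Dv) = ⊥-elim (no-cross-edge chordal x~y H T (here refl) z∈Dv u~z)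
    v-toll : ∀ z → z ∈ walkList G u (P ++ x ∷ y ∷ D) v → v ~ z → z ≡ penult G u (P ++ x ∷ y ∷ D)
    v-toll z z∈ v~z with sides z∈
    ... | inj₂ z∈T = trans (TollTail.toll T z∈T v~z) (sym (penult-++ P (y ∷ D)))
    ... | inj₁ z∈H with ∈-++⁻ (u ∷ P) z∈H
    ...   | inj₁ z∈uP        = ⊥-elim (no-cross-edge chordal x~y H T z∈uP v∈ (~-sym v~z))
    ...   | inj₂ (here refl) = ⊥-elim (proj₂ (proj₂ (TollTail.avoids T v∈)) (~-sym v~z))

  Chordal⇒JC : Chordal G → JC G
  Chordal⇒JC _ _ _ _ _ _ u≢y _ _ _ _ (inj₁ (u≡y , _)) _ _ = ⊥-elim (u≢y u≡y)
  Chordal⇒JC _ _ _ _ _ _ _ _ _ x≢v _ (inj₂ _) (inj₁ (x≡v , _)) _ = ⊥-elim (x≢v x≡v)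
  Chordal⇒JC chordal u x y v u≢x _ u≢v x≢y _ y≢v
             (inj₂ (_ , mid₁ , walk₁ , x∈₁)) (inj₂ (_ , mid₂ , walk₂ , y∈₂)) T-xy
    with ∈-firstSplit Fin._≟_ mid₁ (∈-interior mid₁ x∈₁ u≢x x≢y)
       | ∈-lastSplit Fin._≟_ mid₂ (∈-interior mid₂ y∈₂ x≢y y≢v)
  ... | P , _ , refl , x∉P | _ , D , refl , y∉D =
    inj₂ (u≢v , P ++ x ∷ y ∷ D ,
          splice chordal x~y u≢v (tollHead x~y u≢x x∉P walk₁) (tollTail x~y y≢v y∉D walk₂) ,
          ∈-walkList-++ P (y ∷ D))
    where
    x~y : x ~ y
    x~y = TIsPair⇒~ x≢y T-xy

  -- On an induced cycle c₀ c₁ … c₃₊ₘ, (JC) fails for u′ = c₁, x′ = c₂₊ₘ, y′ = c₃₊ₘ,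
  -- v′ = c₀: c₁ c₂ … c₃₊ₘ and c₂₊ₘ c₃₊ₘ c₀ are toll walks, but T(c₁, c₀) = {c₁, c₀}.
  module InducedCycle (m : ℕ) (c : Fin (4 + m) → V) (cycle : IsInducedCycle G (4 + m) c) where

    h : ℕ → V
    h i = c (i mod (4 + m))

    toℕ-mod : ∀ {i} → i < 4 + m → toℕ (i mod (4 + m)) ≡ i
    toℕ-mod i<K = trans (toℕ-fromℕ< _) (m<n⇒m%n≡m i<K)

    h-distinct : ∀ {a b} → a < 4 + m → b < 4 + m → a ≢ b → h a ≢ h b
    h-distinct a<K b<K a≢b ha≡hb =
      a≢b (trans (sym (toℕ-mod a<K)) (trans (cong toℕ (proj₁ cycle ha≡hb)) (toℕ-mod b<K)))

    h-adjacent⇒ : ∀ {a b} → a < 4 + m → b < 4 + m → h a ~ h b → CyclicallyAdjacent (4 + m) a b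
    h-adjacent⇒ a<K b<K ha~hb =
      subst₂ (CyclicallyAdjacent (4 + m)) (toℕ-mod a<K) (toℕ-mod b<K) (proj₁ (proj₂ cycle _ _) ha~hb)

    h-adjacent⇐ : ∀ {a b} → a < 4 + m → b < 4 + m → CyclicallyAdjacent (4 + m) a b → h a ~ h b
    h-adjacent⇐ a<K b<K adj = proj₂ (proj₂ cycle _ _)
      (subst₂ (CyclicallyAdjacent (4 + m)) (sym (toℕ-mod a<K)) (sym (toℕ-mod b<K)) adj)

    0<K : 0 < 4 + m
    0<K = s≤s z≤n
    1<K : 1 < 4 + m
    1<K = s≤s (s≤s z≤n)
    2+m<K : 2 + m < 4 + m
    2+m<K = m<n⇒m<1+n (n<1+n (2 + m))
    3+m<K : 3 + m < 4 + m
    3+m<K = n<1+n (3 + m)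

    u′ x′ y′ v′ : V
    u′ = h 1
    x′ = h (2 + m)
    y′ = h (3 + m)
    v′ = h 0

    x~y : x′ ~ y′
    x~y = h-adjacent⇐ 2+m<K 3+m<K (inj₁ refl)
    y~v : y′ ~ v′
    y~v = h-adjacent⇐ 3+m<K 0<K (inj₂ (inj₂ (inj₂ (refl , refl))))
    u~v : u′ ~ v′
    u~v = h-adjacent⇐ 1<K 0<K (inj₂ (inj₁ refl))

    ¬x~v : ¬ x′ ~ v′
    ¬x~v x~v with h-adjacent⇒ 2+m<K 0<K x~v
    ... | inj₂ (inj₂ (inj₂ (_ , 3+m≡4+m))) = 1+n≢n (sym 3+m≡4+m)

    long : List V
    long = applyUpTo (λ i → h (2 + i)) (suc m)

    long≡ : walkList G u′ long y′ ≡ applyUpTo (h ∘ suc) (3 + m)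
    long≡ = cong (u′ ∷_) (applyUpTo-∷ʳ (λ i → h (2 + i)) (suc m))

    ∈-long : ∀ {z} → z ∈ walkList G u′ long y′ → ∃ λ i → i < 3 + m × z ≡ h (suc i)
    ∈-long {z} z∈ = ∈-applyUpTo⁻ (h ∘ suc) (subst (z ∈_) long≡ z∈)

    long-toll : IsTollWalk G u′ long y′
    long-toll = h-distinct 1<K 3+m<K (λ ()) , linked , u-toll , y-toll
      where
      linked : Linked _~_ (walkList G u′ long y′)
      linked = subst (Linked _~_) (sym long≡)
        (applyUpTo⁺₁ (h ∘ suc) (3 + m) λ i<M → h-adjacent⇐ (m<n⇒m<1+n i<M) (s≤s i<M) (inj₁ refl))
      u-toll : ∀ z → z ∈ walkList G u′ long y′ → u′ ~ z → z ≡ h 2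
      u-toll z z∈ u~z with ∈-long z∈
      ... | i , i<M , refl with h-adjacent⇒ 1<K (s≤s i<M) u~z
      ...   | inj₁ refl                    = refl
      ...   | inj₂ (inj₁ ())
      ...   | inj₂ (inj₂ (inj₁ (() , _)))
      ...   | inj₂ (inj₂ (inj₂ (() , _)))
      y-toll : ∀ z → z ∈ walkList G u′ long y′ → y′ ~ z → z ≡ penult G u′ long
      y-toll z z∈ y~z with ∈-long z∈
      ... | i , i<M , refl with h-adjacent⇒ 3+m<K (s≤s i<M) y~z
      ...   | inj₁ refl                    = ⊥-elim (<-irrefl refl i<M)
      ...   | inj₂ (inj₁ refl)             = sym (penult-applyUpTo {u = u′} (λ i → h (2 + i)) m)
      ...   | inj₂ (inj₂ (inj₁ (() , _)))
      ...   | inj₂ (inj₂ (inj₂ (() , _)))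

    x∈long : x′ ∈ walkList G u′ long y′
    x∈long = subst (x′ ∈_) (sym long≡) (∈-applyUpTo⁺ (h ∘ suc) (m<n⇒m<1+n (n<1+n (suc m))))

    short-toll : IsTollWalk G x′ (y′ ∷ []) v′
    short-toll = h-distinct 2+m<K 0<K (λ ()) , x~y ∷ y~v ∷ [-] , x-toll , v-toll
      where
      x-toll : ∀ z → z ∈ x′ ∷ y′ ∷ v′ ∷ [] → x′ ~ z → z ≡ y′
      x-toll _ (here refl)                 x~x = ⊥-elim (~-irrefl x~x)
      x-toll _ (there (here refl))         _   = refl
      x-toll _ (there (there (here refl))) x~v = ⊥-elim (¬x~v x~v)
      v-toll : ∀ z → z ∈ x′ ∷ y′ ∷ v′ ∷ [] → v′ ~ z → z ≡ y′
      v-toll _ (here refl)                 v~x = ⊥-elim (¬x~v (~-sym v~x))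
      v-toll _ (there (here refl))         _   = refl
      v-toll _ (there (there (here refl))) v~v = ⊥-elim (~-irrefl v~v)

    u≢x : u′ ≢ x′
    u≢x = h-distinct 1<K 2+m<K (λ ())
    x≢v : x′ ≢ v′
    x≢v = proj₁ short-toll

    ¬JC : ¬ JC G
    ¬JC jc with T-edge⁻ u~v (jc u′ x′ y′ v′ u≢x (proj₁ long-toll) (~⇒≢ u~v) (~⇒≢ x~y) x≢v
                              (~⇒≢ y~v)
                              (inj₂ (proj₁ long-toll , long , long-toll , x∈long))
                              (inj₂ (x≢v , y′ ∷ [] , short-toll , there (here refl)))
                              (~⇒TIsPair x~y))
    ... | inj₁ x≡u = u≢x (sym x≡u)
    ... | inj₂ x≡v = x≢v x≡v

  JC⇒Chordal : JC G → Chordal G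
  JC⇒Chordal jc k 4≤k c cycle with m≤n⇒∃[o]m+o≡n 4≤k
  ... | m , refl = InducedCycle.¬JC m c cycle jc

theorem3 : (n : ℕ) (G : Graph n) → (JC G → Chordal G) × (Chordal G → JC G)
theorem3 n G = JC⇒Chordal G , Chordal⇒JC G
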